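{- Let $T\in\mathfrak{DT}_n$ be a di-sk tree and $v$ a $\ominus$-node of $T$ for which $\mathcal{L}(v,T)$ is defined. Let $\pi=\eta^{ -1}(T)$ and $\pi'=\eta^{ -1}(\mathcal{L}(v,T))$. Then $\mathrm{DESB}(\pi)=\mathrm{DESB}(\pi')$, $\mathrm{LMAX}(\pi)=\mathrm{LMAX}(\pi')$ and $\mathrm{LMIN}(\pi)=\mathrm{LMIN}(\pi')$.
   Context: For $\pi\in\mathfrak{S}_n$: $\mathrm{LMAX}(\pi)=\{\pi_i:\pi_j<\pi_i\ \forall j<i\}$, $\mathrm{LMIN}(\pi)=\{\pi_i:\pi_j>\pi_i\ \forall j<i\}$, $\mathrm{DESB}(\pi)=\{\pi_{i+1}: i\in[n-1],\ \pi_i>\pi_{i+1}\}$. $\mathfrak{S}_n(2413,3142)$ is the set of permutations of $[n]$ avoiding the patterns $2413$ and $3142$. Direct and skew sums: for $\pi\in\mathfrak{S}_k,\sigma\in\mathfrak{S}_l$, $\pi\oplus\sigma=\pi_1\cdots\pi_k(\sigma_1+k)\cdots(\sigma_l+k)$, $\pi\ominus\sigma=(\pi_1+l)\cdots(\pi_k+l)\sigma_1\cdots\sigma_l$. A di-sk tree is a rooted binary tree (each node has at most one left child and at most one right child) with nodes labeled $\oplus$ or $\ominus$ such that no node has the same label as its right child; $\mathfrak{DT}_n$ is the set of di-sk trees with $n-1$ nodes. The bijection $\eta:\mathfrak{S}_n(2413,3142)\to\mathfrak{DT}_n$ is defined recursively: $\eta(1)=\emptyset$; for $n\ge2$ let $i$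 be the largest index in $[n-1]$ with $\min\{\pi_1,\dots,\pi_i\}>\max\{\pi_{i+1},\dots,\pi_n\}$ or $\max\{\pi_1,\dots,\pi_i\}<\min\{\pi_{i+1},\dots,\pi_n\}$; in the first case $\pi=\omega\ominus\rho$ and $\eta(\pi)$ has root $\ominus$, left subtree $\eta(\omega)$, right subtree $\eta(\rho)$; in the second case $\pi=\omega\oplus\rho$ and $\eta(\pi)$ has root $\oplus$, left subtree $\eta(\omega)$, right subtree $\eta(\rho)$. The operation $\mathcal{L}(v,T)$: let $v$ be a $\ominus$-node of the di-sk tree $T$. $\mathcal{L}(v,T)$ is defined when there is an $\oplus$-node $w$ which is not the right child of its parent (it is the root or a left child) such that either (Case 1) $v$ is the left child of $w$, or (Case 2) $w$ has a left child $w'$ which is an $\oplus$-node and $v$ is the right child of $w'$. Let $A$ be the right subtree of $w$, $B$ the right subtree of $v$, $D$ the left subtree of $v$ (any may be empty), and $p$ the parent of $w$ (if any; $w$ is its left child). In Case 1, $\mathcal{L}(v,T)$ is obtained by making $v$ the left child of $p$ (or the root if $w$ was the root), $w$ the left child of $v$, $B$ the right subtree of $v$, $D$ the left subtree of $w$ and $A$ the right subtree of $w$. In Case 2, with $E$ the left subtree of $w'$, $\mathcal{L}(v,T)$ is obtained by making $w'$ the left child of $p$ (or the root if $w$ was the root), with left subtree $E$ and right child $v$; $v$ has right subtree $B$ and left child $w$; $w$ has left subtree $D$ and right subtree $A$. All other nodes and edges are unchanged; the result is again a di-sk tree in $\mathfrak{DT}_n$. -}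

module Defs where

open import Data.Nat using (ℕ; zero; suc; _+_; _<_)
open import Data.List using (List; []; _∷_; _++_; map; length)
open import Data.List.Relation.Unary.All using (All)
open import Data.Product using (_×_; ∃; ∃-syntax)
open import Data.Unit using (⊤)
open import Relation.Binary.PropositionalEquality using (_≡_; _≢_)
open import Function.Bundles using (_⇔_)

-- Permutations are represented as lists of natural numbers (one-line
-- notation π₁ ⋯ πₙ, values in [n]).

_⊕ₚ_ : List ℕ → List ℕ → List ℕ
π ⊕ₚ σ = π ++ map (λ x → x + length π) σ

_⊖ₚ_ : List ℕ → List ℕ → List ℕ
π ⊖ₚ σ = map (λ x → x + length σ) π ++ σ

LMAX : List ℕ → ℕ → Set
LMAX π x = ∃[ pre ] ∃[ suf ] (π ≡ pre ++ x ∷ suf × All (_< x) pre)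

LMIN : List ℕ → ℕ → Set
LMIN π x = ∃[ pre ] ∃[ suf ] (π ≡ pre ++ x ∷ suf × All (x <_) pre)

DESB : List ℕ → ℕ → Set
DESB π x = ∃[ pre ] ∃[ suf ] ∃[ y ] (π ≡ pre ++ y ∷ x ∷ suf × x < y)

SameSet : (ℕ → Set) → (ℕ → Set) → Set
SameSet P Q = ∀ x → P x ⇔ Q x

data Sign : Set where
  ⊕ ⊖ : Sign

-- Rooted binary trees with labelled nodes; `leaf` is the empty tree.
data Tree : Set where
  leaf : Tree
  node : Sign → Tree → Tree → Tree

RightOK : Sign → Tree → Set
RightOK s leaf = ⊤
RightOK s (node s' _ _) = s ≢ s'

DiSk : Tree → Set
DiSk leaf = ⊤
DiSk (node s l r) = DiSk l × DiSk r × RightOK s r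

-- η⁻¹ : 𝔇𝔗ₙ → 𝔖ₙ(2413,3142), obtained by unfolding the recursive
-- definition of η: η(1) = ∅, η(ω ⊕ ρ) = ⊕(η ω, η ρ), η(ω ⊖ ρ) = ⊖(η ω, η ρ).
ηinv : Tree → List ℕ
ηinv leaf = 1 ∷ []
ηinv (node ⊕ l r) = ηinv l ⊕ₚ ηinv r
ηinv (node ⊖ l r) = ηinv l ⊖ₚ ηinv r

-- Nodes of a tree are addressed by paths from the root.

data Dir : Set where
  left right : Dir

Path : Set
Path = List Dir

-- The local rewrite at the ⊕-node w (root of the given subtree);
-- the path is the position of v relative to w.
--   Case 1: v is the left child of w.
--   Case 2: w' (left child of w) is an ⊕-node and v is the right child of w'.
data LocalL : Path → Tree → Tree → Set where
  case1 : ∀ {A B D} →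
    LocalL (left ∷ [])
      (node ⊕ (node ⊖ D B) A)
      (node ⊖ (node ⊕ D A) B)
  case2 : ∀ {A B D E} →
    LocalL (left ∷ right ∷ [])
      (node ⊕ (node ⊕ E (node ⊖ D B)) A)
      (node ⊕ E (node ⊖ (node ⊕ D A) B))

-- IsL v T T' : 𝓛(v,T) is defined and equals T'.
-- `IsL` : w may be the root of the current subtree (this subtree is the whole
--         tree or a left subtree);
-- `IsL'`: w must lie strictly inside the current subtree (this subtree is a
--         right subtree, so its root is a right child).
mutual
  data IsL : Path → Tree → Tree → Set where
    atRoot : ∀ {p T T'} → LocalL p T T' → IsL p T T'
    inLeft : ∀ {p s l l' r} → IsL p l l' →
             IsL (left ∷ p) (node s l r) (node s l' r)
    inRight : ∀ {p s l r r'} → IsL' p r r' →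
              IsL (right ∷ p) (node s l r) (node s l r')

  data IsL' : Path → Tree → Tree → Set where
    inLeft' : ∀ {p s l l' r} → IsL p l l' →
              IsL' (left ∷ p) (node s l r) (node s l' r)
    inRight' : ∀ {p s l r r'} → IsL' p r r' →
               IsL' (right ∷ p) (node s l r) (node s l r')

-- η⁻¹(T) is built from 1 by direct and skew sums, and the three statistics of ω ⊕ ρ and
-- ω ⊖ ρ are determined by those of ω and ρ, their lengths, and the first entry of ρ; for
-- instance DESB(ω ⊖ ρ) = (DESB ω + |ρ|) ∪ {ρ₁} ∪ DESB ρ, because every entry of ω ⊖ ρ
-- coming from ω exceeds every entry coming from ρ. So each tree carries the data
-- (size, first entry, DESB, LMAX, LMIN), computed recursively, and it suffices that 𝓛
-- preserves them. Case 1 only rearranges a union of translates, Case 2 reduces to Case 1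
-- by associativity of ⊕, and the data of a node depend only on the data of its subtrees.

module Submission where

open import Defs
open import Level using (0ℓ)
open import Algebra.Bundles using (CommutativeMonoid)
open import Data.Empty using (⊥-elim)
open import Data.List using (List; []; _∷_; _++_; map; length; head)
open import Data.List.Properties using (length-++; length-map; head-map)
open import Data.List.Membership.Propositional using (_∈_)
open import Data.List.Membership.Propositional.Properties using (∈-map⁻; ∈-++⁻)
open import Data.List.Relation.Unary.All as All using (All; []; _∷_)
open import Data.List.Relation.Unary.Any using (here; there)
open import Data.Maybe using (just)
import Data.Maybe as Maybe
open import Data.Nat using (ℕ; _+_; _<_; _>_; _≤_; s≤s; z≤n)
open import Data.Nat.Properties
  using (+-assoc; +-comm; +-commutativeSemigroup; +-monoˡ-<; +-monoˡ-≤; +-cancelʳ-<; <-asym; ≤-<-trans; ≤-trans; ≤-reflexive; m≤m+n; m≤n+m)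
open import Data.Product using (_×_; _,_; proj₁; proj₂; ∃-syntax)
open import Data.Sum using (inj₁; inj₂)
open import Function.Bundles using (_⇔_; mk⇔; Equivalence)
open import Relation.Nullary using (¬_)
open import Relation.Unary using (Pred; _⊆_; _≐_; _∪_; _∩_; ∅; ｛_｝)
open import Relation.Unary.Properties using (≐-refl; ≐-sym; ≐-trans)
open import Relation.Unary.Algebra using (∪-cong; ∪-assoc; ∪-commutativeMonoid)
open import Relation.Binary.PropositionalEquality
  using (_≡_; _≢_; refl; sym; trans; cong; cong₂; module ≡-Reasoning)
import Algebra.Properties.CommutativeSemigroup as CommutativeSemigroupProperties

module ∪-Properties =
  CommutativeSemigroupProperties (CommutativeMonoid.commutativeSemigroup (∪-commutativeMonoid ℕ 0ℓ))
module +-Properties = CommutativeSemigroupProperties +-commutativeSemigroup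

shift : ℕ → Pred ℕ 0ℓ → Pred ℕ 0ℓ
shift c P x = ∃[ y ] (P y × y + c ≡ x)

shift-cong : ∀ {c c' P Q} → c ≡ c' → P ≐ Q → shift c P ≐ shift c' Q
shift-cong refl (P⊆Q , Q⊆P) =
  (λ (y , Py , eq) → y , P⊆Q Py , eq) , (λ (y , Qy , eq) → y , Q⊆P Qy , eq)

shift-∪ : ∀ c P Q → shift c (P ∪ Q) ≐ shift c P ∪ shift c Q
shift-∪ c P Q =
  (λ { (y , inj₁ Py , eq) → inj₁ (y , Py , eq) ; (y , inj₂ Qy , eq) → inj₂ (y , Qy , eq) }) ,
  (λ { (inj₁ (y , Py , eq)) → y , inj₁ Py , eq ; (inj₂ (y , Qy , eq)) → y , inj₂ Qy , eq })

shift-shift : ∀ a b P → shift a (shift b P) ≐ shift (b + a) P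
shift-shift a b P =
  (λ { (_ , (y , Py , refl) , refl) → y , Py , sym (+-assoc y b a) }) ,
  (λ { (y , Py , refl) → y + b , (y , Py , refl) , +-assoc y b a })

shift-∪-shift : ∀ a b P Q → shift a (P ∪ shift b Q) ≐ shift a P ∪ shift (b + a) Q
shift-∪-shift a b P Q = ≐-trans (shift-∪ a P (shift b Q)) (∪-cong ≐-refl (shift-shift a b Q))

∪-shift-assoc : ∀ a b P Q R → (P ∪ shift a Q) ∪ shift (a + b) R ≐ P ∪ shift a (Q ∪ shift b R)
∪-shift-assoc a b P Q R = ≐-trans (∪-assoc P (shift a Q) (shift (a + b) R)) (∪-cong ≐-refl (≐-sym
  (≐-trans (shift-∪-shift a b Q R) (∪-cong ≐-refl (shift-cong (+-comm b a) ≐-refl)))))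

shift-<-⇔ : ∀ c {a b} → a < b ⇔ a + c < b + c
shift-<-⇔ c {a} {b} = mk⇔ (+-monoˡ-< c) (+-cancelʳ-< c a b)

-- Left-to-right records and descent bottoms, recursively

records : (ℕ → ℕ → Set) → List ℕ → Pred ℕ 0ℓ
records R []      = ∅
records R (y ∷ t) = ｛ y ｝ ∪ R y ∩ records R t

leftMaxima leftMinima : List ℕ → Pred ℕ 0ℓ
leftMaxima = records _<_
leftMinima = records _>_

-- LMAX = Record _<_ and LMIN = Record _>_ definitionally.
Record : (ℕ → ℕ → Set) → List ℕ → Pred ℕ 0ℓ
Record R π x = ∃[ pre ] ∃[ suf ] (π ≡ pre ++ x ∷ suf × All (λ a → R a x) pre)

Record≐records : ∀ R π → Record R π ≐ records R π
Record≐records R π = to , from π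
  where
  to : ∀ {π} → Record R π ⊆ records R π
  to ([] , _ , refl , []) = inj₁ refl
  to (_ ∷ pre , suf , refl , Rax ∷ all) = inj₂ (Rax , to (pre , suf , refl , all))

  from : ∀ π → records R π ⊆ Record R π
  from (y ∷ t) (inj₁ refl) = [] , t , refl , []
  from (y ∷ t) (inj₂ (Ryx , x∈t)) =
    let pre , suf , eq , all = from t x∈t in y ∷ pre , suf , cong (y ∷_) eq , Ryx ∷ all

records-∈ : ∀ R l {x} → records R l x → x ∈ l
records-∈ R (y ∷ l) (inj₁ refl) = here refl
records-∈ R (y ∷ l) (inj₂ (_ , x∈l)) = there (records-∈ R l x∈l)

Beats : (ℕ → ℕ → Set) → List ℕ → Pred ℕ 0ℓ
Beats R l x = All (λ a → R a x) l

records-++ : ∀ R l r → records R (l ++ r) ≐ records R l ∪ Beats R l ∩ records R r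
records-++ R [] r = (λ h → inj₂ ([] , h)) , λ { (inj₂ (_ , h)) → h }
records-++ R (y ∷ l) r = to , from
  where
  ih : records R (l ++ r) ≐ records R l ∪ Beats R l ∩ records R r
  ih = records-++ R l r

  to : records R (y ∷ l ++ r) ⊆ records R (y ∷ l) ∪ Beats R (y ∷ l) ∩ records R r
  to (inj₁ refl) = inj₁ (inj₁ refl)
  to (inj₂ (Ryx , h)) with proj₁ ih h
  ... | inj₁ h'         = inj₁ (inj₂ (Ryx , h'))
  ... | inj₂ (all , h') = inj₂ (Ryx ∷ all , h')

  from : records R (y ∷ l) ∪ Beats R (y ∷ l) ∩ records R r ⊆ records R (y ∷ l ++ r)
  from (inj₁ (inj₁ refl))       = inj₁ refl
  from (inj₁ (inj₂ (Ryx , h)))  = inj₂ (Ryx , proj₂ ih (inj₁ h))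
  from (inj₂ (Ryx ∷ all , h))   = inj₂ (Ryx , proj₂ ih (inj₂ (all , h)))

records-++-dominated : ∀ R l r → (∀ {a b} → a ∈ l → b ∈ r → R a b) →
  records R (l ++ r) ≐ records R l ∪ records R r
records-++-dominated R l r dominated = ≐-trans (records-++ R l r) (∪-cong ≐-refl
  (proj₂ , λ h → All.tabulate (λ a∈l → dominated a∈l (records-∈ R r h)) , h))

records-++-blocked : ∀ R p l r → (∀ {b} → b ∈ r → ¬ R p b) →
  records R (p ∷ l ++ r) ≐ records R (p ∷ l)
records-++-blocked R p l r blocked = ≐-trans (records-++ R (p ∷ l) r)
  ((λ { (inj₁ h) → h ; (inj₂ (Rpx ∷ _ , h)) → ⊥-elim (blocked (records-∈ R r h) Rpx) }) , inj₁)

records-map-+ : ∀ R c → (∀ {a b} → R a b ⇔ R (a + c) (b + c)) →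
  ∀ l → records R (map (_+ c) l) ≐ shift c (records R l)
records-map-+ R c invariant [] = (λ ()) , λ ()
records-map-+ R c invariant (y ∷ l) = to , from
  where
  ih : records R (map (_+ c) l) ≐ shift c (records R l)
  ih = records-map-+ R c invariant l

  to : records R (map (_+ c) (y ∷ l)) ⊆ shift c (records R (y ∷ l))
  to (inj₁ refl) = y , inj₁ refl , refl
  to (inj₂ (R' , h)) with proj₁ ih h
  ... | z , hz , refl = z , inj₂ (Equivalence.from invariant R' , hz) , refl

  from : shift c (records R (y ∷ l)) ⊆ records R (map (_+ c) (y ∷ l))
  from (_ , inj₁ refl , refl) = inj₁ refl
  from (z , inj₂ (Ryz , hz) , refl) = inj₂ (Equivalence.to invariant Ryz , proj₂ ih (z , hz , refl))

descentBottoms : List ℕ → Pred ℕ 0ℓ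
descentBottoms []          = ∅
descentBottoms (a ∷ [])    = ∅
descentBottoms (a ∷ b ∷ t) = ｛ b ｝ ∩ (_< a) ∪ descentBottoms (b ∷ t)

DESB≐descentBottoms : ∀ π → DESB π ≐ descentBottoms π
DESB≐descentBottoms π = to , from π
  where
  to : ∀ {π} → DESB π ⊆ descentBottoms π
  to ([] , _ , _ , refl , x<y) = inj₁ (refl , x<y)
  to (_ ∷ [] , suf , y , refl , x<y) = inj₂ (to ([] , suf , y , refl , x<y))
  to (_ ∷ b ∷ pre , suf , y , refl , x<y) = inj₂ (to (b ∷ pre , suf , y , refl , x<y))

  from : ∀ π → descentBottoms π ⊆ DESB π
  from (a ∷ b ∷ t) (inj₁ (refl , x<a)) = [] , t , a , refl , x<a
  from (a ∷ b ∷ t) (inj₂ h) =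
    let pre , suf , y , eq , x<y = from (b ∷ t) h in a ∷ pre , suf , y , cong (a ∷_) eq , x<y

infix 4 _≪_
_≪_ : List ℕ → List ℕ → Set
l ≪ r = ∀ {a b} → a ∈ l → b ∈ r → a < b

descentBottoms-++-≪ : ∀ l r → l ≪ r →
  descentBottoms (l ++ r) ≐ descentBottoms l ∪ descentBottoms r
descentBottoms-++-≪ [] r _ = inj₂ , λ { (inj₂ h) → h }
descentBottoms-++-≪ (a ∷ []) [] _ = (λ ()) , λ { (inj₁ ()) ; (inj₂ ()) }
descentBottoms-++-≪ (a ∷ []) (b ∷ r) l≪r =
  (λ { (inj₁ (refl , b<a)) → ⊥-elim (<-asym b<a (l≪r (here refl) (here refl))) ; (inj₂ h) → inj₂ h }) ,
  λ { (inj₂ h) → inj₂ h }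
descentBottoms-++-≪ (a ∷ b ∷ l) r l≪r = ≐-trans
  (∪-cong ≐-refl (descentBottoms-++-≪ (b ∷ l) r (λ a∈ → l≪r (there a∈))))
  (≐-sym (∪-assoc _ _ _))

descentBottoms-++-≫ : ∀ p l q r → q ∷ r ≪ p ∷ l →
  descentBottoms (p ∷ l ++ q ∷ r) ≐ descentBottoms (p ∷ l) ∪ ｛ q ｝ ∪ descentBottoms (q ∷ r)
descentBottoms-++-≫ p [] q r r≪l =
  (λ { (inj₁ (refl , _)) → inj₂ (inj₁ refl) ; (inj₂ h) → inj₂ (inj₂ h) }) ,
  (λ { (inj₂ (inj₁ refl)) → inj₁ (refl , r≪l (here refl) (here refl)) ; (inj₂ (inj₂ h)) → inj₂ h })
descentBottoms-++-≫ p (a ∷ l) q r r≪l = ≐-trans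
  (∪-cong ≐-refl (descentBottoms-++-≫ a l q r (λ b∈ a∈ → r≪l b∈ (there a∈))))
  (≐-sym (∪-assoc _ _ _))

descentBottoms-map-+ : ∀ c l → descentBottoms (map (_+ c) l) ≐ shift c (descentBottoms l)
descentBottoms-map-+ c [] = (λ ()) , λ ()
descentBottoms-map-+ c (a ∷ []) = (λ ()) , λ ()
descentBottoms-map-+ c (a ∷ b ∷ l) = cons (descentBottoms-map-+ c (b ∷ l))
  where
  cons : descentBottoms (map (_+ c) (b ∷ l)) ≐ shift c (descentBottoms (b ∷ l)) →
         descentBottoms (map (_+ c) (a ∷ b ∷ l)) ≐ shift c (descentBottoms (a ∷ b ∷ l))
  cons (to , from) =
    (λ { (inj₁ (refl , lt)) → b , inj₁ (refl , Equivalence.from (shift-<-⇔ c) lt) , refl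
       ; (inj₂ h) → let y , hy , eq = to h in y , inj₂ hy , eq }) ,
    (λ { (_ , inj₁ (refl , lt) , refl) → inj₁ (refl , Equivalence.to (shift-<-⇔ c) lt)
       ; (y , inj₂ hy , eq) → inj₂ (from (y , hy , eq)) })

-- Statistics of direct and skew sums

InRange : List ℕ → Set
InRange π = ∀ {x} → x ∈ π → 0 < x × x ≤ length π

≪-shifted : ∀ {l r} → InRange l → InRange r → l ≪ map (_+ length l) r
≪-shifted {l} {r} l-range r-range a∈l b∈r with ∈-map⁻ (_+ length l) b∈r
... | b , b∈r , refl = ≤-<-trans (proj₂ (l-range a∈l)) (+-monoˡ-< (length l) (proj₁ (r-range b∈r)))

length-⊕ : ∀ π σ → length (π ⊕ₚ σ) ≡ length π + length σ
length-⊕ π σ = trans (length-++ π) (cong (length π +_) (length-map _ σ))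

length-⊖ : ∀ π σ → length (π ⊖ₚ σ) ≡ length π + length σ
length-⊖ π σ = trans (length-++ (map _ π)) (cong (_+ length σ) (length-map _ π))

inRange-⊕ : ∀ π σ → InRange π → InRange σ → InRange (π ⊕ₚ σ)
inRange-⊕ π σ π-range σ-range x∈ rewrite length-⊕ π σ with ∈-++⁻ π x∈
... | inj₁ x∈π = let 0<x , x≤ = π-range x∈π in 0<x , ≤-trans x≤ (m≤m+n _ _)
... | inj₂ x∈σ with ∈-map⁻ (_+ length π) x∈σ
... | y , y∈σ , refl = let 0<y , y≤ = σ-range y∈σ in
  ≤-trans 0<y (m≤m+n y _) , ≤-trans (+-monoˡ-≤ (length π) y≤) (≤-reflexive (+-comm (length σ) (length π)))

inRange-⊖ : ∀ π σ → InRange π → InRange σ → InRange (π ⊖ₚ σ)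
inRange-⊖ π σ π-range σ-range x∈ rewrite length-⊖ π σ with ∈-++⁻ (map _ π) x∈
... | inj₂ x∈σ = let 0<x , x≤ = σ-range x∈σ in 0<x , ≤-trans x≤ (m≤n+m _ _)
... | inj₁ x∈π with ∈-map⁻ (_+ length σ) x∈π
... | y , y∈π , refl = let 0<y , y≤ = π-range y∈π in
  ≤-trans 0<y (m≤m+n y _) , +-monoˡ-≤ (length σ) y≤

leftMaxima-map-+ : ∀ c l → leftMaxima (map (_+ c) l) ≐ shift c (leftMaxima l)
leftMaxima-map-+ c = records-map-+ _<_ c (shift-<-⇔ c)

leftMinima-map-+ : ∀ c l → leftMinima (map (_+ c) l) ≐ shift c (leftMinima l)
leftMinima-map-+ c = records-map-+ _>_ c (shift-<-⇔ c)

leftMaxima-⊕ : ∀ π σ → InRange π → InRange σ →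
  leftMaxima (π ⊕ₚ σ) ≐ leftMaxima π ∪ shift (length π) (leftMaxima σ)
leftMaxima-⊕ π σ π-range σ-range = ≐-trans
  (records-++-dominated _<_ π _ (≪-shifted π-range σ-range))
  (∪-cong ≐-refl (leftMaxima-map-+ (length π) σ))

leftMinima-⊕ : ∀ π σ → InRange π → InRange σ → π ≢ [] →
  leftMinima (π ⊕ₚ σ) ≐ leftMinima π
leftMinima-⊕ [] _ _ _ []≢[] = ⊥-elim ([]≢[] refl)
leftMinima-⊕ (p ∷ π) σ π-range σ-range _ = records-++-blocked _>_ p π _
  (λ b∈ → <-asym (≪-shifted π-range σ-range (here refl) b∈))

descentBottoms-⊕ : ∀ π σ → InRange π → InRange σ →
  descentBottoms (π ⊕ₚ σ) ≐ descentBottoms π ∪ shift (length π) (descentBottoms σ)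
descentBottoms-⊕ π σ π-range σ-range = ≐-trans
  (descentBottoms-++-≪ π _ (≪-shifted π-range σ-range))
  (∪-cong ≐-refl (descentBottoms-map-+ (length π) σ))

leftMaxima-⊖ : ∀ π σ → InRange π → InRange σ → π ≢ [] →
  leftMaxima (π ⊖ₚ σ) ≐ shift (length σ) (leftMaxima π)
leftMaxima-⊖ [] _ _ _ []≢[] = ⊥-elim ([]≢[] refl)
leftMaxima-⊖ (p ∷ π) σ π-range σ-range _ = ≐-trans
  (records-++-blocked _<_ (p + length σ) (map (_+ length σ) π) σ
    (λ b∈ → <-asym (≪-shifted σ-range π-range b∈ (here refl))))
  (leftMaxima-map-+ (length σ) (p ∷ π))

leftMinima-⊖ : ∀ π σ → InRange π → InRange σ →
  leftMinima (π ⊖ₚ σ) ≐ shift (length σ) (leftMinima π) ∪ leftMinima σ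
leftMinima-⊖ π σ π-range σ-range = ≐-trans
  (records-++-dominated _>_ (map _ π) σ (λ a∈ b∈ → ≪-shifted σ-range π-range b∈ a∈))
  (∪-cong (leftMinima-map-+ (length σ) π) ≐-refl)

descentBottoms-⊖ : ∀ π σ {q} → InRange π → InRange σ → π ≢ [] → head σ ≡ just q →
  descentBottoms (π ⊖ₚ σ) ≐ shift (length σ) (descentBottoms π) ∪ ｛ q ｝ ∪ descentBottoms σ
descentBottoms-⊖ [] _ _ _ []≢[] _ = ⊥-elim ([]≢[] refl)
descentBottoms-⊖ (p ∷ π) (q ∷ σ) π-range σ-range _ refl = ≐-trans
  (descentBottoms-++-≫ (p + length (q ∷ σ)) _ q σ (≪-shifted σ-range π-range))
  (∪-cong (descentBottoms-map-+ (length (q ∷ σ)) (p ∷ π)) ≐-refl)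

-- Statistics of η⁻¹(T), computed on the tree

size : Tree → ℕ
size leaf         = 1
size (node _ l r) = size l + size r

first : Tree → ℕ
first leaf         = 1
first (node ⊕ l r) = first l
first (node ⊖ l r) = first l + size r

DESBᵀ LMAXᵀ LMINᵀ : Tree → Pred ℕ 0ℓ
DESBᵀ leaf         = descentBottoms (1 ∷ [])
DESBᵀ (node ⊕ l r) = DESBᵀ l ∪ shift (size l) (DESBᵀ r)
DESBᵀ (node ⊖ l r) = shift (size r) (DESBᵀ l) ∪ ｛ first r ｝ ∪ DESBᵀ r
LMAXᵀ leaf         = leftMaxima (1 ∷ [])
LMAXᵀ (node ⊕ l r) = LMAXᵀ l ∪ shift (size l) (LMAXᵀ r)
LMAXᵀ (node ⊖ l r) = shift (size r) (LMAXᵀ l)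
LMINᵀ leaf         = leftMinima (1 ∷ [])
LMINᵀ (node ⊕ l r) = LMINᵀ l
LMINᵀ (node ⊖ l r) = shift (size r) (LMINᵀ l) ∪ LMINᵀ r

length-ηinv : ∀ T → length (ηinv T) ≡ size T
length-ηinv leaf         = refl
length-ηinv (node ⊕ l r) = trans (length-⊕ (ηinv l) (ηinv r)) (cong₂ _+_ (length-ηinv l) (length-ηinv r))
length-ηinv (node ⊖ l r) = trans (length-⊖ (ηinv l) (ηinv r)) (cong₂ _+_ (length-ηinv l) (length-ηinv r))

head-++ : ∀ {A : Set} {a : A} (l r : List A) → head l ≡ just a → head (l ++ r) ≡ just a
head-++ (_ ∷ _) _ eq = eq

head-ηinv : ∀ T → head (ηinv T) ≡ just (first T)
head-ηinv leaf         = refl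
head-ηinv (node ⊕ l r) = head-++ (ηinv l) _ (head-ηinv l)
head-ηinv (node ⊖ l r) = head-++ (map _ (ηinv l)) _ (begin
  head (map (_+ length (ηinv r)) (ηinv l))       ≡⟨ head-map (ηinv l) ⟩
  Maybe.map (_+ length (ηinv r)) (head (ηinv l)) ≡⟨ cong (Maybe.map _) (head-ηinv l) ⟩
  just (first l + length (ηinv r))               ≡⟨ cong (λ n → just (first l + n)) (length-ηinv r) ⟩
  just (first l + size r)                        ∎)
  where open ≡-Reasoning

ηinv-nonempty : ∀ T → ηinv T ≢ []
ηinv-nonempty T eq with () ← trans (cong head (sym eq)) (head-ηinv T)

inRange-ηinv : ∀ T → InRange (ηinv T)
inRange-ηinv leaf (here refl) = s≤s z≤n , s≤s z≤n
inRange-ηinv (node ⊕ l r) = inRange-⊕ (ηinv l) (ηinv r) (inRange-ηinv l) (inRange-ηinv r)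
inRange-ηinv (node ⊖ l r) = inRange-⊖ (ηinv l) (ηinv r) (inRange-ηinv l) (inRange-ηinv r)

descentBottoms-ηinv : ∀ T → descentBottoms (ηinv T) ≐ DESBᵀ T
descentBottoms-ηinv leaf         = ≐-refl
descentBottoms-ηinv (node ⊕ l r) = ≐-trans
  (descentBottoms-⊕ (ηinv l) (ηinv r) (inRange-ηinv l) (inRange-ηinv r))
  (∪-cong (descentBottoms-ηinv l) (shift-cong (length-ηinv l) (descentBottoms-ηinv r)))
descentBottoms-ηinv (node ⊖ l r) = ≐-trans
  (descentBottoms-⊖ (ηinv l) (ηinv r) (inRange-ηinv l) (inRange-ηinv r) (ηinv-nonempty l) (head-ηinv r))
  (∪-cong (shift-cong (length-ηinv r) (descentBottoms-ηinv l)) (∪-cong ≐-refl (descentBottoms-ηinv r)))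

leftMaxima-ηinv : ∀ T → leftMaxima (ηinv T) ≐ LMAXᵀ T
leftMaxima-ηinv leaf         = ≐-refl
leftMaxima-ηinv (node ⊕ l r) = ≐-trans
  (leftMaxima-⊕ (ηinv l) (ηinv r) (inRange-ηinv l) (inRange-ηinv r))
  (∪-cong (leftMaxima-ηinv l) (shift-cong (length-ηinv l) (leftMaxima-ηinv r)))
leftMaxima-ηinv (node ⊖ l r) = ≐-trans
  (leftMaxima-⊖ (ηinv l) (ηinv r) (inRange-ηinv l) (inRange-ηinv r) (ηinv-nonempty l))
  (shift-cong (length-ηinv r) (leftMaxima-ηinv l))

leftMinima-ηinv : ∀ T → leftMinima (ηinv T) ≐ LMINᵀ T
leftMinima-ηinv leaf         = ≐-refl
leftMinima-ηinv (node ⊕ l r) = ≐-trans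
  (leftMinima-⊕ (ηinv l) (ηinv r) (inRange-ηinv l) (inRange-ηinv r) (ηinv-nonempty l))
  (leftMinima-ηinv l)
leftMinima-ηinv (node ⊖ l r) = ≐-trans
  (leftMinima-⊖ (ηinv l) (ηinv r) (inRange-ηinv l) (inRange-ηinv r))
  (∪-cong (shift-cong (length-ηinv r) (leftMinima-ηinv l)) (leftMinima-ηinv r))

DESB-ηinv : ∀ T → DESB (ηinv T) ≐ DESBᵀ T
DESB-ηinv T = ≐-trans (DESB≐descentBottoms (ηinv T)) (descentBottoms-ηinv T)

LMAX-ηinv : ∀ T → LMAX (ηinv T) ≐ LMAXᵀ T
LMAX-ηinv T = ≐-trans (Record≐records _<_ (ηinv T)) (leftMaxima-ηinv T)

LMIN-ηinv : ∀ T → LMIN (ηinv T) ≐ LMINᵀ T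
LMIN-ηinv T = ≐-trans (Record≐records _>_ (ηinv T)) (leftMinima-ηinv T)

-- Trees with the same statistics

infix 4 _≈ₛ_
record _≈ₛ_ (T T' : Tree) : Set where
  field
    size≡  : size T ≡ size T'
    first≡ : first T ≡ first T'
    DESB≐  : DESBᵀ T ≐ DESBᵀ T'
    LMAX≐  : LMAXᵀ T ≐ LMAXᵀ T'
    LMIN≐  : LMINᵀ T ≐ LMINᵀ T'

≈ₛ-trans : ∀ {T T' T''} → T ≈ₛ T' → T' ≈ₛ T'' → T ≈ₛ T''
≈ₛ-trans p q = record
  { size≡  = trans (size≡ p) (size≡ q)
  ; first≡ = trans (first≡ p) (first≡ q)
  ; DESB≐  = ≐-trans (DESB≐ p) (DESB≐ q)
  ; LMAX≐  = ≐-trans (LMAX≐ p) (LMAX≐ q)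
  ; LMIN≐  = ≐-trans (LMIN≐ p) (LMIN≐ q)
  }
  where open _≈ₛ_

node-congˡ : ∀ {s l l' r} → l ≈ₛ l' → node s l r ≈ₛ node s l' r
node-congˡ {⊕} {r = r} l≈l' = record
  { size≡  = cong (_+ size r) size≡
  ; first≡ = first≡
  ; DESB≐  = ∪-cong DESB≐ (shift-cong size≡ ≐-refl)
  ; LMAX≐  = ∪-cong LMAX≐ (shift-cong size≡ ≐-refl)
  ; LMIN≐  = LMIN≐
  }
  where open _≈ₛ_ l≈l'
node-congˡ {⊖} {r = r} l≈l' = record
  { size≡  = cong (_+ size r) size≡
  ; first≡ = cong (_+ size r) first≡
  ; DESB≐  = ∪-cong (shift-cong refl DESB≐) ≐-refl
  ; LMAX≐  = shift-cong refl LMAX≐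
  ; LMIN≐  = ∪-cong (shift-cong refl LMIN≐) ≐-refl
  }
  where open _≈ₛ_ l≈l'

node-congʳ : ∀ {s l r r'} → r ≈ₛ r' → node s l r ≈ₛ node s l r'
node-congʳ {⊕} {l} r≈r' = record
  { size≡  = cong (size l +_) size≡
  ; first≡ = refl
  ; DESB≐  = ∪-cong ≐-refl (shift-cong refl DESB≐)
  ; LMAX≐  = ∪-cong ≐-refl (shift-cong refl LMAX≐)
  ; LMIN≐  = ≐-refl
  }
  where open _≈ₛ_ r≈r'
node-congʳ {⊖} {l} r≈r' = record
  { size≡  = cong (size l +_) size≡
  ; first≡ = cong (first l +_) size≡
  ; DESB≐  = ∪-cong (shift-cong size≡ ≐-refl) (∪-cong (singleton-cong first≡) DESB≐)
  ; LMAX≐  = shift-cong size≡ ≐-refl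
  ; LMIN≐  = ∪-cong (shift-cong size≡ ≐-refl) LMIN≐
  }
  where
  open _≈ₛ_ r≈r'
  singleton-cong : ∀ {a b} → a ≡ b → ｛ a ｝ ≐ ｛ b ｝
  singleton-cong refl = ≐-refl

⊕-assocₛ : ∀ E X A → node ⊕ (node ⊕ E X) A ≈ₛ node ⊕ E (node ⊕ X A)
⊕-assocₛ E X A = record
  { size≡  = +-assoc (size E) (size X) (size A)
  ; first≡ = refl
  ; DESB≐  = ∪-shift-assoc (size E) (size X) (DESBᵀ E) (DESBᵀ X) (DESBᵀ A)
  ; LMAX≐  = ∪-shift-assoc (size E) (size X) (LMAXᵀ E) (LMAXᵀ X) (LMAXᵀ A)
  ; LMIN≐  = ≐-refl
  }

⊖⊕-swapₛ : ∀ D B A → node ⊕ (node ⊖ D B) A ≈ₛ node ⊖ (node ⊕ D A) B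
⊖⊕-swapₛ D B A = record
  { size≡  = +-Properties.xy∙z≈xz∙y d b (size A)
  ; first≡ = refl
  ; DESB≐  = ≐-trans (∪-Properties.xy∙z≈xz∙y (shift b (DESBᵀ D)) (｛ first B ｝ ∪ DESBᵀ B) (shift (d + b) (DESBᵀ A)))
                     (∪-cong (≐-sym (shift-∪-shift b d (DESBᵀ D) (DESBᵀ A))) ≐-refl)
  ; LMAX≐  = ≐-sym (shift-∪-shift b d (LMAXᵀ D) (LMAXᵀ A))
  ; LMIN≐  = ≐-refl
  }
  where
  d b : ℕ
  d = size D
  b = size B

LocalL⇒≈ₛ : ∀ {p T T'} → LocalL p T T' → T ≈ₛ T'
LocalL⇒≈ₛ (case1 {A} {B} {D}) = ⊖⊕-swapₛ D B A
LocalL⇒≈ₛ (case2 {A} {B} {D} {E}) =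
  ≈ₛ-trans (⊕-assocₛ E (node ⊖ D B) A) (node-congʳ (⊖⊕-swapₛ D B A))

mutual
  IsL⇒≈ₛ : ∀ {p T T'} → IsL p T T' → T ≈ₛ T'
  IsL⇒≈ₛ (atRoot step) = LocalL⇒≈ₛ step
  IsL⇒≈ₛ (inLeft step) = node-congˡ (IsL⇒≈ₛ step)
  IsL⇒≈ₛ (inRight step) = node-congʳ (IsL'⇒≈ₛ step)

  IsL'⇒≈ₛ : ∀ {p T T'} → IsL' p T T' → T ≈ₛ T'
  IsL'⇒≈ₛ (inLeft' step) = node-congˡ (IsL⇒≈ₛ step)
  IsL'⇒≈ₛ (inRight' step) = node-congʳ (IsL'⇒≈ₛ step)

≐⇒SameSet : ∀ {P Q : Pred ℕ 0ℓ} → P ≐ Q → SameSet P Q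
≐⇒SameSet (P⊆Q , Q⊆P) x = mk⇔ P⊆Q Q⊆P

lemma3p1 : (T T' : Tree) (v : Path) → DiSk T → IsL v T T' →
    SameSet (DESB (ηinv T)) (DESB (ηinv T'))
      × SameSet (LMAX (ηinv T)) (LMAX (ηinv T'))
      × SameSet (LMIN (ηinv T)) (LMIN (ηinv T'))
lemma3p1 T T' _ _ T↦T' =
  transfer DESB DESB-ηinv DESB≐ , transfer LMAX LMAX-ηinv LMAX≐ , transfer LMIN LMIN-ηinv LMIN≐
  where
  open _≈ₛ_ (IsL⇒≈ₛ T↦T')
  transfer : ∀ (S : List ℕ → Pred ℕ 0ℓ) {Sᵀ : Tree → Pred ℕ 0ℓ} →
    (∀ T → S (ηinv T) ≐ Sᵀ T) → Sᵀ T ≐ Sᵀ T' → SameSet (S (ηinv T)) (S (ηinv T'))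
  transfer _ S-ηinv Sᵀ≐ = ≐⇒SameSet (≐-trans (S-ηinv T) (≐-trans Sᵀ≐ (≐-sym (S-ηinv T'))))
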